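{- The $\lambda$-theory $\mathrm{Th}(\mathcal{S})=\{(M,N)\mid M,N\ \lambda\text{ -terms},\ [\![M]\!]_\rho=[\![N]\!]_\rho\text{ for all valuations }\rho\}$ is neither extensional nor sensible.
   Context: Addressing machines. Fix a countable set $\mathbb{A}$ of addresses and a symbol $\varnothing\notin\mathbb{A}$; put $\mathbb{A}_\varnothing=\mathbb{A}\cup\{\varnothing\}$. A tape is a finite list of elements of $\mathbb{A}$; $a::T$ has head $a$ and tail $T$, $T@T'$ is concatenation. A program is a finite list of instructions generated by $P::=\mathtt{Load}\ i;P\mid A$, $A::=\mathtt{App}(i,j,k);A\mid C$, $C::=\mathtt{Call}\ i\mid\varepsilon$ ($i,j,k\in\mathbb{N}$). For $r\in\mathbb{N}$, $I\subseteq\{0,\dots,r-1\}$, $I\models^r P$ is the least relation such that: $I\models^r\varepsilon$; $I\models^r\mathtt{Call}\ i$ if $i\in I$; $I\models^r\mathtt{App}(i,j,k);A$ if $i,j\in I$ and either ($k<r$ and $I\cup\{k\}\models^r A$) or ($k\ge r$ and $I\models^r A$); $I\models^r\mathtt{Load}\ i;P$ if either ($i<r$ and $I\cup\{i\}\models^r P$) or ($i\ge r$ and $I\models^r P$). An addressing machine is $M=\langle R_0,\dots,R_{r-1},P,T\rangle$ with registers in $\mathbb{A}_\varnothing$, $P$ valid w.r.t. the registers ($\{i<r\mid R_i\ne\varnothing\}\models^r P$), and a tape $T$; $\mathcal{M}$ is the set of all of them, components $M.\vec R,M.P,M.T$. $\vec R[R_i:=a]$ replaces $R_i$ by $a$ if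 $i<r$, and is $\vec R$ if $i\ge r$. $M$ is stuck if $M.P=\mathtt{Load}\ i;P'$ and $M.T=[]$. Fix a bijection $\#:\mathcal{M}\to\mathbb{A}$ with inverse $\#^{ -1}$; $M@T'=\langle M.\vec R,M.P,M.T@T'\rangle$; $a\cdot b=\#(\#^{ -1}(a)@[b])$. Head reduction: $\langle\vec R,\mathtt{Load}\ i;P,a::T\rangle\to_h\langle\vec R[R_i:=a],P,T\rangle$, $\langle\vec R,\mathtt{App}(i,j,k);P,T\rangle\to_h\langle\vec R[R_k:=R_i\cdot R_j],P,T\rangle$, $\langle\vec R,\mathtt{Call}\ i,T\rangle\to_h\#^{ -1}(R_i)@T$; $\twoheadrightarrow_h$ reflexive-transitive closure; "$M\twoheadrightarrow_h\mathrm{stuck}$" means $M\twoheadrightarrow_h N$ for some stuck $N$. Induced relations: for a relation $\equiv_R$ on $\mathcal{M}$, $a\simeq_R b$ iff $\#^{ -1}(a)\equiv_R\#^{ -1}(b)$; on $\mathbb{A}_\varnothing$, both $\varnothing$ or both addresses related; componentwise on tuples/tapes of equal length; $M=_R N$ iff $M.\vec R\simeq_R N.\vec R$, $M.P=N.P$, $M.T\simeq_R N.T$. Applicative equivalence $\equiv^{ae}$ is the least equivalence relation on $\mathcal{M}$ such that: (1) $M\twoheadrightarrow_h Z=^{ae}N$ implies $M\equiv^{ae}N$; (2) if $M\twoheadrightarrow_h\mathrm{stuck}$, $N\twoheadrightarrow_h\mathrm{stuck}$ and $M@[a]\equiv^{ae}N@[a]$ for all $a\in\mathbb{A}$, then $M\equiv^{ae}N$;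 $\simeq^{ae},=^{ae}$ are induced by $\equiv^{ae}$. Interpretation: for $\lambda$-terms possibly containing constants $\underline{a}$ ($a\in\mathbb{A}$) and a list $\vec x=x_1,\dots,x_n$ of distinct variables containing $\mathrm{FV}(M)$: $[\![x_i]\!]^{\vec x}=\langle\varnothing,(\mathtt{Load}\ 1)^{i-1};\mathtt{Load}\ 0;(\mathtt{Load}\ 1)^{n-i};\mathtt{Call}\ 0,[]\rangle$; $[\![\underline{a}]\!]^{\vec x}=\langle a,(\mathtt{Load}\ 1)^n;\mathtt{Call}\ 0,[]\rangle$; $[\![MN]\!]^{\vec x}=\langle\varnothing^n,\#[\![M]\!]^{\vec x},\#[\![N]\!]^{\vec x},\varnothing,\mathtt{Apply}_n,[]\rangle$ with $\mathtt{Apply}_n=\mathtt{Load}\ 0;\dots;\mathtt{Load}\ (n-1);\mathtt{App}(n,0,n);\dots;\mathtt{App}(n,n-1,n);\mathtt{App}(n+1,0,n+1);\dots;\mathtt{App}(n+1,n-1,n+1);\mathtt{App}(n,n+1,n+2);\mathtt{Call}\ (n+2)$; $[\![\lambda y.M]\!]^{\vec x}=[\![M]\!]^{\vec x,y}$ ($y\notin\vec x$). For $\rho:\mathrm{Var}\to\mathbb{A}$, $[\![M]\!]_\rho$ is the $\simeq^{ae}$-class of $\#([\![M]\!]^{\vec x}@[\rho(x_1),\dots,\rho(x_n)])$ (independent of the choice of $\vec x\supseteq\mathrm{FV}(M)$); $\mathcal{S}$ is the resulting syntactic $\lambda$-model on $\mathbb{A}/_{\simeq^{ae}}$. A $\lambda$-theory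 is extensional if it contains $\eta$-conversion; it is sensible if it is consistent (does not equate all $\lambda$-terms) and equates all unsolvable $\lambda$-terms, where $M$ is solvable iff $(\lambda\vec x.M)\vec P=_\beta\lambda x.x$ for some $\vec x,\vec P$. -}

module Defs where

open import Data.Nat using (ℕ; zero; suc; _+_; _∸_; _<ᵇ_; _≡ᵇ_; _<_; _≤_; s≤s; z≤n)
open import Data.Nat.Properties using (<⇒<ᵇ; <ᵇ⇒<; ≡⇒≡ᵇ; m≤m+n; +-suc; ≤-trans; n≤1+n)
open import Data.Bool using (Bool; true; false; _∧_; _∨_; if_then_else_; T)
open import Data.Unit using (⊤; tt)
open import Data.Empty using (⊥)
open import Data.Maybe using (Maybe; just; nothing; is-just)
open import Data.List using (List; []; _∷_; _++_; length; replicate; map; reverse; upTo; applyUpTo)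
open import Data.List.Properties using (length-++; length-replicate)
open import Data.List.Relation.Unary.All using (All; []; _∷_)
open import Data.List.Relation.Unary.All.Properties using (applyUpTo⁺₁)
open import Data.Fin using (Fin; toℕ) renaming (zero to fzero; suc to fsuc)
open import Data.List using (allFin)
open import Data.Product using (Σ; _×_; _,_)
open import Function using (id)
open import Function.Bundles using (_↔_; Inverse; _↣_)
open import Relation.Nullary using (¬_)
open import Relation.Binary.PropositionalEquality using (_≡_; refl; subst; sym)
open import Relation.Binary.Construct.Closure.ReflexiveTransitive using (Star)
open import Relation.Binary.Construct.Closure.Equivalence using (EqClosure)
import Data.List.Relation.Binary.Pointwise as LP
import Data.Maybe.Relation.Binary.Pointwise as MP

data CProg : Set where
  call : ℕ → CProg
  ε    : CProg

data AProg : Set where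
  app : ℕ → ℕ → ℕ → AProg → AProg
  cp  : CProg → AProg

data Prog : Set where
  load : ℕ → Prog → Prog
  ap   : AProg → Prog

Subset : Set
Subset = ℕ → Bool

_∪｛_｝ : Subset → ℕ → Subset
(I ∪｛ k ｝) x = (x ≡ᵇ k) ∨ I x

-- I ⊨^r P  (the least relation of the paper, written as a boolean check)
validC : ℕ → Subset → CProg → Bool
validC r I (call i) = I i
validC r I ε        = true

validA : ℕ → Subset → AProg → Bool
validA r I (app i j k A) = I i ∧ (I j ∧ (if k <ᵇ r then validA r (I ∪｛ k ｝) A else validA r I A))
validA r I (cp C)        = validC r I C

validP : ℕ → Subset → Prog → Bool
validP r I (load i P) = if i <ᵇ r then validP r (I ∪｛ i ｝) P else validP r I P
validP r I (ap A)     = validA r I A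

loadRep : ℕ → ℕ → Prog → Prog
loadRep zero    i P = P
loadRep (suc m) i P = load i (loadRep m i P)

loadSeq : List ℕ → Prog → Prog
loadSeq []       P = P
loadSeq (j ∷ js) P = load j (loadSeq js P)

appSeq : ℕ → ℕ → List ℕ → AProg → AProg
appSeq i k []       A = A
appSeq i k (j ∷ js) A = app i j k (appSeq i k js A)

Apply : ℕ → Prog
Apply n = loadSeq (upTo n)
  (ap (appSeq n n (upTo n) (appSeq (suc n) (suc n) (upTo n)
    (app n (suc n) (suc (suc n)) (cp (call (suc (suc n))))))))

_⊆_ : Subset → Subset → Set
I ⊆ J = ∀ x → T (I x) → T (J x)

∧-intro : ∀ {a b} → T a → T b → T (a ∧ b)
∧-intro {true} _ tb = tb

∧-l : ∀ {a b} → T (a ∧ b) → T a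
∧-l {true} _ = tt

∧-r : ∀ {a b} → T (a ∧ b) → T b
∧-r {true} t = t

∪-mono : ∀ {I J} k → I ⊆ J → (I ∪｛ k ｝) ⊆ (J ∪｛ k ｝)
∪-mono k h x t with x ≡ᵇ k
... | true  = tt
... | false = h x t

∪-incl : ∀ I k → I ⊆ (I ∪｛ k ｝)
∪-incl I k x t with x ≡ᵇ k
... | true  = tt
... | false = t

∪-self : ∀ I k → T ((I ∪｛ k ｝) k)
∪-self I k with k ≡ᵇ k | ≡⇒≡ᵇ k k refl
... | true | _ = tt

monoC : ∀ r {I J} → I ⊆ J → ∀ C → T (validC r I C) → T (validC r J C)
monoC r h (call i) t = h i t
monoC r h ε t = tt

monoA : ∀ r {I J} → I ⊆ J → ∀ A → T (validA r I A) → T (validA r J A)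
monoA r {I} {J} h (app i j k A) t with k <ᵇ r
... | true  = ∧-intro (h i (∧-l t)) (∧-intro (h j (∧-l (∧-r {I i} t)))
                (monoA r (∪-mono k h) A (∧-r {I j} (∧-r {I i} t))))
... | false = ∧-intro (h i (∧-l t)) (∧-intro (h j (∧-l (∧-r {I i} t)))
                (monoA r h A (∧-r {I j} (∧-r {I i} t))))
monoA r h (cp C) t = monoC r h C t

monoP : ∀ r {I J} → I ⊆ J → ∀ P → T (validP r I P) → T (validP r J P)
monoP r h (load i P) t with i <ᵇ r
... | true  = monoP r (∪-mono i h) P t
... | false = monoP r h P t
monoP r h (ap A) t = monoA r h A t

loadRep-skip : ∀ I m P → T (validP 1 I P) → T (validP 1 I (loadRep m 1 P))
loadRep-skip I zero    P t = t
loadRep-skip I (suc m) P t = loadRep-skip I m P t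

_∪*_ : Subset → List ℕ → Subset
I ∪* []       = I
I ∪* (j ∷ js) = (I ∪｛ j ｝) ∪* js

∪*-incl : ∀ I js → I ⊆ (I ∪* js)
∪*-incl I []       x t = t
∪*-incl I (j ∷ js) x t = ∪*-incl (I ∪｛ j ｝) js x (∪-incl I j x t)

∪*-all : ∀ I js → All (λ j → T ((I ∪* js) j)) js
∪*-all I []       = []
∪*-all I (j ∷ js) = ∪*-incl (I ∪｛ j ｝) js j (∪-self I j) ∷ ∪*-all (I ∪｛ j ｝) js

loadSeq-valid : ∀ r I js P → All (λ j → T (j <ᵇ r)) js →
                T (validP r (I ∪* js) P) → T (validP r I (loadSeq js P))
loadSeq-valid r I []       P []       t = t
loadSeq-valid r I (j ∷ js) P (b ∷ bs) t with j <ᵇ r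
... | true  = loadSeq-valid r (I ∪｛ j ｝) js P bs t

appSeq-valid : ∀ r J i k js A → T (J i) → All (λ j → T (J j)) js → T (k <ᵇ r) →
               T (J k) → T (validA r J A) → T (validA r J (appSeq i k js A))
appSeq-valid r J i k []       A ti []         kr tk tA = tA
appSeq-valid r J i k (j ∷ js) A ti (tj ∷ tjs) kr tk tA =
  ∧-intro ti (∧-intro tj (if-true (k <ᵇ r) kr
    (monoA r (∪-incl J k) (appSeq i k js A) (appSeq-valid r J i k js A ti tjs kr tk tA))))
  where
  if-true : ∀ c {x y} → T c → T x → T (if c then x else y)
  if-true true _ t = t

Apply-valid : ∀ n r I → T (suc (suc n) <ᵇ r) → T (I n) → T (I (suc n)) →
              T (validP r I (Apply n))
Apply-valid n r I b tn tsn =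
  loadSeq-valid r I (upTo n) _
    (applyUpTo⁺₁ id n (λ {j} j<n → <⇒<ᵇ (≤-trans j<n (≤-trans (n≤1+n n) n<r))))
    (appSeq-valid r J n n (upTo n) _ (inc n tn) (∪*-all I (upTo n)) (<⇒<ᵇ n<r) (inc n tn)
      (appSeq-valid r J (suc n) (suc n) (upTo n) _ (inc (suc n) tsn) (∪*-all I (upTo n))
        (<⇒<ᵇ sn<r) (inc (suc n) tsn) final))
  where
  J = I ∪* upTo n
  inc = ∪*-incl I (upTo n)
  ssn<r : suc (suc n) < r
  ssn<r = <ᵇ⇒< (suc (suc n)) r b
  sn<r : suc n < r
  sn<r = ≤-trans (n≤1+n _) ssn<r
  n<r : n < r
  n<r = ≤-trans (n≤1+n _) sn<r
  final : T (validA r J (app n (suc n) (suc (suc n)) (cp (call (suc (suc n))))))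
  final = ∧-intro (inc n tn) (∧-intro (inc (suc n) tsn) (go (suc (suc n) <ᵇ r) b))
    where
    go : ∀ c → T c → T (if c then validA r (J ∪｛ suc (suc n) ｝) (cp (call (suc (suc n))))
                             else validA r J (cp (call (suc (suc n)))))
    go true _ = ∪-self J (suc (suc n))

-- A term of Λ n has its free variables among x₁ … xₙ, where the
-- variable xᵢ is the de Bruijn index n - i  (so λy.M with M : Λ (suc n)
-- binds y = x_{n+1} = index 0, matching [[λy.M]]^x = [[M]]^{x,y}).

infixl 7 _·_

data Λ (n : ℕ) : Set where
  var : Fin n → Λ n
  _·_ : Λ n → Λ n → Λ n
  ƛ   : Λ (suc n) → Λ n

extR : ∀ {n m} → (Fin n → Fin m) → Fin (suc n) → Fin (suc m)
extR ρ fzero    = fzero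
extR ρ (fsuc x) = fsuc (ρ x)

rename : ∀ {n m} → (Fin n → Fin m) → Λ n → Λ m
rename ρ (var x) = var (ρ x)
rename ρ (M · N) = rename ρ M · rename ρ N
rename ρ (ƛ M)   = ƛ (rename (extR ρ) M)

extS : ∀ {n m} → (Fin n → Λ m) → Fin (suc n) → Λ (suc m)
extS σ fzero    = var fzero
extS σ (fsuc x) = rename fsuc (σ x)

substitute : ∀ {n m} → (Fin n → Λ m) → Λ n → Λ m
substitute σ (var x) = σ x
substitute σ (M · N) = substitute σ M · substitute σ N
substitute σ (ƛ M)   = ƛ (substitute (extS σ) M)

_[_] : ∀ {n} → Λ (suc n) → Λ n → Λ n
_[_] {n} M N = substitute σ M
  where
  σ : Fin (suc n) → Λ n
  σ fzero    = N
  σ (fsuc x) = var x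

data _→β_ : ∀ {n} → Λ n → Λ n → Set where
  β   : ∀ {n} {M : Λ (suc n)} {N : Λ n} → (ƛ M · N) →β (M [ N ])
  ξₗ  : ∀ {n} {M M' N : Λ n} → M →β M' → (M · N) →β (M' · N)
  ξᵣ  : ∀ {n} {M N N' : Λ n} → N →β N' → (M · N) →β (M · N')
  ξƛ  : ∀ {n} {M M' : Λ (suc n)} → M →β M' → ƛ M →β ƛ M'

_=β_ : ∀ {n} → Λ n → Λ n → Set
_=β_ = EqClosure _→β_

lams : ∀ n → Λ n → Λ 0
lams zero    M = M
lams (suc n) M = lams n (ƛ M)

weaken₀ : ∀ {m} → Λ 0 → Λ m
weaken₀ = rename (λ ())

apps : ∀ {m} → Λ m → List (Λ m) → Λ m
apps M []       = M
apps M (P ∷ Ps) = apps (M · P) Ps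

Id : ∀ {m} → Λ m
Id = ƛ (var fzero)

Solvable : ∀ {n} → Λ n → Set
Solvable {n} M = Σ ℕ λ m → Σ (List (Λ m)) λ Ps → apps (weaken₀ (lams n M)) Ps =β Id

Unsolvable : ∀ {n} → Λ n → Set
Unsolvable M = ¬ Solvable M

TermRel : Set₁
TermRel = ∀ {n} → Λ n → Λ n → Set

Extensional : TermRel → Set
Extensional Th = ∀ {n} (M : Λ n) → Th (ƛ (rename fsuc M · var fzero)) M

Consistent : TermRel → Set
Consistent Th = ¬ (∀ {n} (M N : Λ n) → Th M N)

Sensible : TermRel → Set
Sensible Th = Consistent Th × (∀ {n} (M N : Λ n) → Unsolvable M → Unsolvable N → Th M N)

module AM (A : Set) where

  -- registers: the list R₀ … R_{r-1}; nothing = ∅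
  Regs : Set
  Regs = List (Maybe A)

  get : Regs → ℕ → Maybe A
  get []       i       = nothing
  get (x ∷ xs) zero    = x
  get (x ∷ xs) (suc i) = get xs i

  -- R[R_i := a] (no change if i ≥ r)
  set : Regs → ℕ → A → Regs
  set []       i       a = []
  set (x ∷ xs) zero    a = just a ∷ xs
  set (x ∷ xs) (suc i) a = x ∷ set xs i a

  occ : Regs → Subset
  occ R i = is-just (get R i)

  record Machine : Set where
    constructor mach
    field
      regs  : Regs
      prog  : Prog
      valid : T (validP (length regs) (occ regs) prog)
      tape  : List A
  open Machine public

  Stuck : Machine → Set
  Stuck M = Σ ℕ λ i → Σ Prog λ P → (prog M ≡ load i P) × (tape M ≡ [])

  _＠_ : Machine → List A → Machine
  M ＠ T' = record M { tape = tape M ++ T' }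

  module Induced (_≈_ : Machine → Machine → Set) (#⁻¹ : A → Machine) where
    _≃_ : A → A → Set
    a ≃ b = #⁻¹ a ≈ #⁻¹ b

    _≃∅_ : Maybe A → Maybe A → Set
    _≃∅_ = MP.Pointwise _≃_

    _=R_ : Machine → Machine → Set
    M =R N = LP.Pointwise _≃∅_ (regs M) (regs N) × (prog M ≡ prog N)
             × LP.Pointwise _≃_ (tape M) (tape N)

  replicate-get₀ : ∀ n (xs : Regs) → get (replicate n nothing ++ xs) n ≡ get xs 0
  replicate-get₀ zero    xs = refl
  replicate-get₀ (suc n) xs = replicate-get₀ n xs

  replicate-get₁ : ∀ n (xs : Regs) → get (replicate n nothing ++ xs) (suc n) ≡ get xs 1
  replicate-get₁ zero    xs = refl
  replicate-get₁ (suc n) xs = replicate-get₁ n xs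

  replicate-len : ∀ n (x y z : Maybe A) →
                  T (suc (suc n) <ᵇ length (replicate n nothing ++ x ∷ y ∷ z ∷ []))
  replicate-len zero    x y z = tt
  replicate-len (suc n) x y z = replicate-len n x y z

  varMachine : ℕ → ℕ → Machine
  varMachine n i =
    mach (nothing ∷ [])
         (loadRep (i ∸ 1) 1 (load 0 (loadRep (n ∸ i) 1 (ap (cp (call 0))))))
         (loadRep-skip (occ (nothing ∷ [])) (i ∸ 1) _
           (loadRep-skip (occ (nothing ∷ []) ∪｛ 0 ｝) (n ∸ i) _
             (∪-self (occ (nothing ∷ [])) 0)))
         []

  appMachine : ℕ → A → A → Machine
  appMachine n a b =
    mach R (Apply n)
         (Apply-valid n (length R) (occ R) (replicate-len n _ _ _)
           (subst (λ m → T (is-just m)) (sym (replicate-get₀ n xs)) tt)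
           (subst (λ m → T (is-just m)) (sym (replicate-get₁ n xs)) tt))
         []
    where
    xs : Regs
    xs = just a ∷ just b ∷ nothing ∷ []
    R : Regs
    R = replicate n nothing ++ xs

  module Coded (code : Machine ↔ A) where

    # : Machine → A
    # = Inverse.to code

    #⁻¹ : A → Machine
    #⁻¹ = Inverse.from code

    infixl 7 _•_
    _•_ : A → A → A
    a • b = # (#⁻¹ a ＠ (b ∷ []))

    data _→h_ : Machine → Machine → Set where
      h-load : ∀ {M N i P a T} → prog M ≡ load i P → tape M ≡ a ∷ T →
               regs N ≡ set (regs M) i a → prog N ≡ P → tape N ≡ T → M →h N
      h-app  : ∀ {M N i j k A' a b} → prog M ≡ ap (app i j k A') →
               get (regs M) i ≡ just a → get (regs M) j ≡ just b →
               regs N ≡ set (regs M) k (a • b) → prog N ≡ ap A' → tape N ≡ tape M → M →h N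
      h-call : ∀ {M i a} → prog M ≡ ap (cp (call i)) → get (regs M) i ≡ just a →
               M →h (#⁻¹ a ＠ tape M)

    _↠h_ : Machine → Machine → Set
    _↠h_ = Star _→h_

    ↠stuck : Machine → Set
    ↠stuck M = Σ Machine λ N → (M ↠h N) × Stuck N

    data _≡ae_ : Machine → Machine → Set where
      ae-refl  : ∀ {M} → M ≡ae M
      ae-sym   : ∀ {M N} → M ≡ae N → N ≡ae M
      ae-trans : ∀ {M N L} → M ≡ae N → N ≡ae L → M ≡ae L
      ae-red   : ∀ {M Z N} → M ↠h Z → Induced._=R_ _≡ae_ #⁻¹ Z N → M ≡ae N
      ae-ext   : ∀ {M N} → ↠stuck M → ↠stuck N →
                 (∀ a → (M ＠ (a ∷ [])) ≡ae (N ＠ (a ∷ []))) → M ≡ae N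

    _≃ae_ : A → A → Set
    _≃ae_ = Induced._≃_ _≡ae_ #⁻¹

    ⟦_⟧ᵐ : ∀ {n} → Λ n → Machine
    ⟦_⟧ᵐ {n} (var k) = varMachine n (n ∸ toℕ k)
    ⟦_⟧ᵐ {n} (M · N) = appMachine n (# ⟦ M ⟧ᵐ) (# ⟦ N ⟧ᵐ)
    ⟦_⟧ᵐ {n} (ƛ M)   = ⟦ M ⟧ᵐ

    env : ∀ {n} → (Fin n → A) → List A
    env {n} ρ = map ρ (reverse (allFin n))

    -- a representative of [[M]]_ρ (an element of the ≃ae-class)
    ⟦_⟧_ : ∀ {n} → Λ n → (Fin n → A) → A
    ⟦ M ⟧ ρ = # (⟦ M ⟧ᵐ ＠ env ρ)

    ThS : TermRel
    ThS M N = ∀ ρ → (⟦ M ⟧ ρ) ≃ae (⟦ N ⟧ ρ)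

Countable : Set → Set
Countable A = A ↣ ℕ

-- Both separations rest on one invariant of applicative equivalence: equivalent machines
-- either both reach a stuck machine or neither does.  Since rule (1) compares registers and
-- tapes up to ≃ae itself, this is proved through a step-indexed logical relation on
-- addresses that contains ≃ae and is a simulation.
--
-- Not extensional: with ρ(x) the address of a machine with the empty program, ⟦λy.xy⟧ρ is
-- stuck after loading its single argument, while ⟦x⟧ρ calls that machine and terminates
-- without ever getting stuck.  Not sensible: Ω and λx.Ω are unsolvable (Ω reduces only to
-- itself, so by Church–Rosser no term with Ω at its head converts to λx.x), yet ⟦λx.Ω⟧ is
-- stuck at once while ⟦Ω⟧ runs forever through the self-application of ω.

module Submission where

open import Defs
open import Data.Product using (_×_)
open import Function.Bundles using (_↔_)
open import Relation.Nullary using (¬_)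
open import Data.Nat using (ℕ; zero; suc)
open import Data.Bool using (T)
open import Data.Bool.Properties using (T-irrelevant)
open import Data.Unit using (⊤; tt)
open import Data.Empty using (⊥-elim)
open import Data.Fin using (Fin) renaming (zero to fzero; suc to fsuc)
open import Data.Maybe using (just; nothing)
open import Data.List using (List; []; _∷_; _++_; length)
open import Data.List.Properties using (++-assoc; ++-identityʳ)
open import Data.Product using (∃; _,_; proj₁; proj₂; swap)
open import Function using (_∘_)
open import Function.Bundles using (Inverse)
open import Relation.Binary.PropositionalEquality
  using (_≡_; _≗_; refl; sym; trans; cong; cong₂; subst)
open import Relation.Binary.Construct.Closure.ReflexiveTransitive using (Star; ε; _◅_; _◅◅_)
open import Relation.Binary.Construct.Closure.Symmetric using (fwd; bwd)
import Data.List.Relation.Binary.Pointwise as LP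
open LP using ([]; _∷_)
import Data.Maybe.Relation.Binary.Pointwise as MP

extR-cong : ∀ {n m} {ρ ρ′ : Fin n → Fin m} → ρ ≗ ρ′ → extR ρ ≗ extR ρ′
extR-cong e fzero    = refl
extR-cong e (fsuc x) = cong fsuc (e x)

extS-cong : ∀ {n m} {σ σ′ : Fin n → Λ m} → σ ≗ σ′ → extS σ ≗ extS σ′
extS-cong e fzero    = refl
extS-cong e (fsuc x) = cong (rename fsuc) (e x)

rename-cong : ∀ {n m} {ρ ρ′ : Fin n → Fin m} → ρ ≗ ρ′ → rename ρ ≗ rename ρ′
rename-cong e (var x) = cong var (e x)
rename-cong e (M · N) = cong₂ _·_ (rename-cong e M) (rename-cong e N)
rename-cong e (ƛ M)   = cong ƛ (rename-cong (extR-cong e) M)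

substitute-cong : ∀ {n m} {σ σ′ : Fin n → Λ m} → σ ≗ σ′ → substitute σ ≗ substitute σ′
substitute-cong e (var x) = e x
substitute-cong e (M · N) = cong₂ _·_ (substitute-cong e M) (substitute-cong e N)
substitute-cong e (ƛ M)   = cong ƛ (substitute-cong (extS-cong e) M)

extR-extR : ∀ {n m k} (ρ : Fin m → Fin k) (ρ′ : Fin n → Fin m) →
            extR ρ ∘ extR ρ′ ≗ extR (ρ ∘ ρ′)
extR-extR ρ ρ′ fzero    = refl
extR-extR ρ ρ′ (fsuc x) = refl

rename-rename : ∀ {n m k} (ρ : Fin m → Fin k) (ρ′ : Fin n → Fin m) →
                rename ρ ∘ rename ρ′ ≗ rename (ρ ∘ ρ′)
rename-rename ρ ρ′ (var x) = refl
rename-rename ρ ρ′ (M · N) = cong₂ _·_ (rename-rename ρ ρ′ M) (rename-rename ρ ρ′ N)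
rename-rename ρ ρ′ (ƛ M)   =
  cong ƛ (trans (rename-rename (extR ρ) (extR ρ′) M) (rename-cong (extR-extR ρ ρ′) M))

extS-extR : ∀ {n m k} (σ : Fin m → Λ k) (ρ : Fin n → Fin m) →
            extS σ ∘ extR ρ ≗ extS (σ ∘ ρ)
extS-extR σ ρ fzero    = refl
extS-extR σ ρ (fsuc x) = refl

substitute-rename : ∀ {n m k} (σ : Fin m → Λ k) (ρ : Fin n → Fin m) →
                    substitute σ ∘ rename ρ ≗ substitute (σ ∘ ρ)
substitute-rename σ ρ (var x) = refl
substitute-rename σ ρ (M · N) = cong₂ _·_ (substitute-rename σ ρ M) (substitute-rename σ ρ N)
substitute-rename σ ρ (ƛ M)   =
  cong ƛ (trans (substitute-rename (extS σ) (extR ρ) M) (substitute-cong (extS-extR σ ρ) M))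

extR-extS : ∀ {n m k} (ρ : Fin m → Fin k) (σ : Fin n → Λ m) →
            rename (extR ρ) ∘ extS σ ≗ extS (rename ρ ∘ σ)
extR-extS ρ σ fzero    = refl
extR-extS ρ σ (fsuc x) = trans (rename-rename (extR ρ) fsuc (σ x)) (sym (rename-rename fsuc ρ (σ x)))

rename-substitute : ∀ {n m k} (ρ : Fin m → Fin k) (σ : Fin n → Λ m) →
                    rename ρ ∘ substitute σ ≗ substitute (rename ρ ∘ σ)
rename-substitute ρ σ (var x) = refl
rename-substitute ρ σ (M · N) = cong₂ _·_ (rename-substitute ρ σ M) (rename-substitute ρ σ N)
rename-substitute ρ σ (ƛ M)   =
  cong ƛ (trans (rename-substitute (extR ρ) (extS σ) M) (substitute-cong (extR-extS ρ σ) M))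

extS-extS : ∀ {n m k} (τ : Fin m → Λ k) (σ : Fin n → Λ m) →
            substitute (extS τ) ∘ extS σ ≗ extS (substitute τ ∘ σ)
extS-extS τ σ fzero    = refl
extS-extS τ σ (fsuc x) =
  trans (substitute-rename (extS τ) fsuc (σ x)) (sym (rename-substitute fsuc τ (σ x)))

substitute-substitute : ∀ {n m k} (τ : Fin m → Λ k) (σ : Fin n → Λ m) →
                        substitute τ ∘ substitute σ ≗ substitute (substitute τ ∘ σ)
substitute-substitute τ σ (var x) = refl
substitute-substitute τ σ (M · N) =
  cong₂ _·_ (substitute-substitute τ σ M) (substitute-substitute τ σ N)
substitute-substitute τ σ (ƛ M)   =
  cong ƛ (trans (substitute-substitute (extS τ) (extS σ) M) (substitute-cong (extS-extS τ σ) M))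

extS-var : ∀ {n} → extS {n} var ≗ var
extS-var fzero    = refl
extS-var (fsuc x) = refl

substitute-var : ∀ {n} → substitute {n} var ≗ (λ M → M)
substitute-var (var x) = refl
substitute-var (M · N) = cong₂ _·_ (substitute-var M) (substitute-var N)
substitute-var (ƛ M)   = cong ƛ (trans (substitute-cong extS-var M) (substitute-var M))

single : ∀ {n} → Λ n → Fin (suc n) → Λ n
single N fzero    = N
single N (fsuc x) = var x

[]-substitute : ∀ {n} (M : Λ (suc n)) N → M [ N ] ≡ substitute (single N) M
[]-substitute M N = substitute-cong (λ { fzero → refl ; (fsuc x) → refl }) M

rename-[] : ∀ {n m} (ρ : Fin n → Fin m) M N →
            rename ρ (M [ N ]) ≡ rename (extR ρ) M [ rename ρ N ]
rename-[] ρ M N = trans (cong (rename ρ) ([]-substitute M N))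
  (trans (rename-substitute ρ (single N) M)
  (trans (substitute-cong single-extR M)
  (trans (sym (substitute-rename (single (rename ρ N)) (extR ρ) M))
         (sym ([]-substitute (rename (extR ρ) M) (rename ρ N))))))
  where
  single-extR : rename ρ ∘ single N ≗ single (rename ρ N) ∘ extR ρ
  single-extR fzero    = refl
  single-extR (fsuc x) = refl

substitute-[] : ∀ {n m} (σ : Fin n → Λ m) M N →
                substitute σ (M [ N ]) ≡ substitute (extS σ) M [ substitute σ N ]
substitute-[] σ M N = trans (cong (substitute σ) ([]-substitute M N))
  (trans (substitute-substitute σ (single N) M)
  (trans (substitute-cong single-extS M)
  (trans (sym (substitute-substitute (single (substitute σ N)) (extS σ) M))
         (sym ([]-substitute (substitute (extS σ) M) (substitute σ N))))))
  where
  single-extS : substitute σ ∘ single N ≗ substitute (single (substitute σ N)) ∘ extS σ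
  single-extS fzero    = refl
  single-extS (fsuc x) =
    sym (trans (substitute-rename (single (substitute σ N)) fsuc (σ x)) (substitute-var (σ x)))

infix 4 _⇛_ _⇛*_

data _⇛_ {n} : Λ n → Λ n → Set where
  ⇛-var : ∀ {x} → var x ⇛ var x
  ⇛-ƛ   : ∀ {M M′} → M ⇛ M′ → ƛ M ⇛ ƛ M′
  ⇛-·   : ∀ {M M′ N N′} → M ⇛ M′ → N ⇛ N′ → M · N ⇛ M′ · N′
  ⇛-β   : ∀ {M M′ N N′} → M ⇛ M′ → N ⇛ N′ → ƛ M · N ⇛ M′ [ N′ ]

_⇛*_ : ∀ {n} → Λ n → Λ n → Set
_⇛*_ = Star _⇛_

⇛-refl : ∀ {n} (M : Λ n) → M ⇛ M
⇛-refl (var x) = ⇛-var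
⇛-refl (M · N) = ⇛-· (⇛-refl M) (⇛-refl N)
⇛-refl (ƛ M)   = ⇛-ƛ (⇛-refl M)

⇛-rename : ∀ {n m} (ρ : Fin n → Fin m) {M M′} → M ⇛ M′ → rename ρ M ⇛ rename ρ M′
⇛-rename ρ ⇛-var     = ⇛-var
⇛-rename ρ (⇛-ƛ p)   = ⇛-ƛ (⇛-rename (extR ρ) p)
⇛-rename ρ (⇛-· p q) = ⇛-· (⇛-rename ρ p) (⇛-rename ρ q)
⇛-rename ρ (⇛-β {M′ = M′} {N′ = N′} p q) =
  subst (_ ⇛_) (sym (rename-[] ρ M′ N′)) (⇛-β (⇛-rename (extR ρ) p) (⇛-rename ρ q))

⇛-extS : ∀ {n m} {σ σ′ : Fin n → Λ m} → (∀ x → σ x ⇛ σ′ x) → ∀ x → extS σ x ⇛ extS σ′ x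
⇛-extS s fzero    = ⇛-var
⇛-extS s (fsuc x) = ⇛-rename fsuc (s x)

⇛-substitute : ∀ {n m} {σ σ′ : Fin n → Λ m} → (∀ x → σ x ⇛ σ′ x) →
               ∀ {M M′} → M ⇛ M′ → substitute σ M ⇛ substitute σ′ M′
⇛-substitute s ⇛-var     = s _
⇛-substitute s (⇛-ƛ p)   = ⇛-ƛ (⇛-substitute (⇛-extS s) p)
⇛-substitute s (⇛-· p q) = ⇛-· (⇛-substitute s p) (⇛-substitute s q)
⇛-substitute {σ′ = σ′} s (⇛-β {M′ = M′} {N′ = N′} p q) =
  subst (_ ⇛_) (sym (substitute-[] σ′ M′ N′))
    (⇛-β (⇛-substitute (⇛-extS s) p) (⇛-substitute s q))

⇛-[] : ∀ {n} {M M′ : Λ (suc n)} {N N′} → M ⇛ M′ → N ⇛ N′ → M [ N ] ⇛ M′ [ N′ ]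
⇛-[] {M = M} {M′} {N} {N′} p q
  rewrite []-substitute M N | []-substitute M′ N′ = ⇛-substitute ⇛-single p
  where
  ⇛-single : ∀ x → single N x ⇛ single N′ x
  ⇛-single fzero    = q
  ⇛-single (fsuc x) = ⇛-var

develop : ∀ {n} → Λ n → Λ n
develop (var x)         = var x
develop (ƛ M)           = ƛ (develop M)
develop (var x · N)     = var x · develop N
develop ((M₁ · M₂) · N) = develop (M₁ · M₂) · develop N
develop (ƛ M · N)       = develop M [ develop N ]

⇛-develop : ∀ {n} {M M′ : Λ n} → M ⇛ M′ → M′ ⇛ develop M
⇛-develop ⇛-var                     = ⇛-var
⇛-develop (⇛-ƛ p)                   = ⇛-ƛ (⇛-develop p)
⇛-develop (⇛-· {M = var x} p q)     = ⇛-· (⇛-develop p) (⇛-develop q)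
⇛-develop (⇛-· {M = M₁ · M₂} p q)   = ⇛-· (⇛-develop p) (⇛-develop q)
⇛-develop (⇛-· {M = ƛ M} (⇛-ƛ p) q) = ⇛-β (⇛-develop p) (⇛-develop q)
⇛-develop (⇛-β p q)                 = ⇛-[] (⇛-develop p) (⇛-develop q)

⇛-strip : ∀ {n} {M M₁ M₂ : Λ n} → M ⇛ M₁ → M ⇛* M₂ → ∃ λ L → M₁ ⇛* L × M₂ ⇛ L
⇛-strip {M₁ = M₁} p ε = M₁ , ε , p
⇛-strip p (q ◅ qs) with ⇛-strip (⇛-develop q) qs
... | L , r , s = L , ⇛-develop p ◅ r , s

⇛*-confluent : ∀ {n} {M M₁ M₂ : Λ n} → M ⇛* M₁ → M ⇛* M₂ → ∃ λ L → M₁ ⇛* L × M₂ ⇛* L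
⇛*-confluent {M₂ = M₂} ε q = M₂ , q , ε
⇛*-confluent (p ◅ ps) q with ⇛-strip p q
... | L₁ , r , s with ⇛*-confluent ps r
... | L , u , t = L , u , s ◅ t

→β⇒⇛ : ∀ {n} {M N : Λ n} → M →β N → M ⇛ N
→β⇒⇛ (β {M = M} {N}) = ⇛-β (⇛-refl M) (⇛-refl N)
→β⇒⇛ (ξₗ {N = N} r)  = ⇛-· (→β⇒⇛ r) (⇛-refl N)
→β⇒⇛ (ξᵣ {M = M} r)  = ⇛-· (⇛-refl M) (→β⇒⇛ r)
→β⇒⇛ (ξƛ r)          = ⇛-ƛ (→β⇒⇛ r)

church-rosser : ∀ {n} {M N : Λ n} → M =β N → ∃ λ L → M ⇛* L × N ⇛* L
church-rosser {M = M} ε = M , ε , ε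
church-rosser (fwd r ◅ rs) with church-rosser rs
... | L , p , q = L , →β⇒⇛ r ◅ p , q
church-rosser (bwd r ◅ rs) with church-rosser rs
... | L₁ , p , q with ⇛*-confluent (→β⇒⇛ r ◅ ε) p
... | L , u , t = L , u , q ◅◅ t

ω : ∀ {n} → Λ n
ω = ƛ (var fzero · var fzero)

Ω : ∀ {n} → Λ n
Ω = ω · ω

data ΩHeaded {n} : Λ n → Set where
  Ω-head : ΩHeaded Ω
  ƛ-head : ∀ {M} → ΩHeaded M → ΩHeaded (ƛ M)
  ·-head : ∀ {M N} → ΩHeaded M → ΩHeaded (M · N)

ΩHeaded-rename : ∀ {n m} (ρ : Fin n → Fin m) {M} → ΩHeaded M → ΩHeaded (rename ρ M)
ΩHeaded-rename ρ Ω-head     = Ω-head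
ΩHeaded-rename ρ (ƛ-head h) = ƛ-head (ΩHeaded-rename (extR ρ) h)
ΩHeaded-rename ρ (·-head h) = ·-head (ΩHeaded-rename ρ h)

ΩHeaded-substitute : ∀ {n m} (σ : Fin n → Λ m) {M} → ΩHeaded M → ΩHeaded (substitute σ M)
ΩHeaded-substitute σ Ω-head     = Ω-head
ΩHeaded-substitute σ (ƛ-head h) = ƛ-head (ΩHeaded-substitute (extS σ) h)
ΩHeaded-substitute σ (·-head h) = ·-head (ΩHeaded-substitute σ h)

ΩHeaded-⇛ : ∀ {n} {M M′ : Λ n} → ΩHeaded M → M ⇛ M′ → ΩHeaded M′
ΩHeaded-⇛ Ω-head (⇛-· (⇛-ƛ (⇛-· ⇛-var ⇛-var)) (⇛-ƛ (⇛-· ⇛-var ⇛-var))) = Ω-head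
ΩHeaded-⇛ Ω-head (⇛-β (⇛-· ⇛-var ⇛-var) (⇛-ƛ (⇛-· ⇛-var ⇛-var)))     = Ω-head
ΩHeaded-⇛ (ƛ-head h) (⇛-ƛ p)   = ƛ-head (ΩHeaded-⇛ h p)
ΩHeaded-⇛ (·-head h) (⇛-· p q) = ·-head (ΩHeaded-⇛ h p)
ΩHeaded-⇛ (·-head (ƛ-head h)) (⇛-β {M′ = M′} {N′ = N′} p q) =
  subst ΩHeaded (sym ([]-substitute M′ N′)) (ΩHeaded-substitute (single N′) (ΩHeaded-⇛ h p))

ΩHeaded-⇛* : ∀ {n} {M M′ : Λ n} → ΩHeaded M → M ⇛* M′ → ΩHeaded M′
ΩHeaded-⇛* h ε        = h
ΩHeaded-⇛* h (p ◅ ps) = ΩHeaded-⇛* (ΩHeaded-⇛ h p) ps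

ΩHeaded-apps : ∀ {n} {M : Λ n} Ps → ΩHeaded M → ΩHeaded (apps M Ps)
ΩHeaded-apps []       h = h
ΩHeaded-apps (P ∷ Ps) h = ΩHeaded-apps Ps (·-head h)

ΩHeaded-lams : ∀ n {M : Λ n} → ΩHeaded M → ΩHeaded (lams n M)
ΩHeaded-lams zero    h = h
ΩHeaded-lams (suc n) h = ΩHeaded-lams n (ƛ-head h)

Id-⇛* : ∀ {n} {L : Λ n} → Id ⇛* L → L ≡ Id
Id-⇛* ε                    = refl
Id-⇛* (⇛-ƛ ⇛-var ◅ ps) = Id-⇛* ps

¬ΩHeaded-Id : ∀ {n} → ¬ ΩHeaded {n} Id
¬ΩHeaded-Id (ƛ-head ())

ΩHeaded⇒unsolvable : ∀ {n} {M : Λ n} → ΩHeaded M → Unsolvable M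
ΩHeaded⇒unsolvable {n} h (_ , Ps , Ps-solve) with church-rosser Ps-solve
... | L , reduct , Id-reduct =
  ¬ΩHeaded-Id (subst ΩHeaded (Id-⇛* Id-reduct)
    (ΩHeaded-⇛* (ΩHeaded-apps Ps (ΩHeaded-rename _ (ΩHeaded-lams n h))) reduct))

module Machines (A : Set) (code : AM.Machine A ↔ A) where
  open AM A
  open Coded code

  variable
    k : ℕ
    a b : A
    R : Regs
    S U : List A
    M N X Y Z : Machine

  machine-≡ : regs M ≡ regs N → prog M ≡ prog N → tape M ≡ tape N → M ≡ N
  machine-≡ {mach R P v S} {mach .R .P w .S} refl refl refl =
    cong (λ u → mach R P u S) (T-irrelevant v w)

  #⁻¹∘# : ∀ M → #⁻¹ (# M) ≡ M
  #⁻¹∘# = Inverse.strictlyInverseʳ code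

  ＠-++ : ∀ M S U → (M ＠ S) ＠ U ≡ M ＠ (S ++ U)
  ＠-++ M S U = machine-≡ refl refl (++-assoc (tape M) S U)

  ＠-[] : ∀ M → M ＠ [] ≡ M
  ＠-[] M = machine-≡ refl refl (++-identityʳ (tape M))

  #⁻¹-• : ∀ a b S → #⁻¹ (a • b) ＠ S ≡ #⁻¹ a ＠ (b ∷ S)
  #⁻¹-• a b S = trans (cong (_＠ S) (#⁻¹∘# _)) (＠-++ (#⁻¹ a) (b ∷ []) S)

  #-• : ∀ M b S → #⁻¹ (# M • b) ＠ S ≡ M ＠ (b ∷ S)
  #-• M b S = trans (#⁻¹-• (# M) b S) (cong (_＠ (b ∷ S)) (#⁻¹∘# M))

  Config : Set
  Config = Regs × Prog × List A

  config : Machine → Config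
  config M = regs M , prog M , tape M

  config-injective : config M ≡ config N → M ≡ N
  config-injective refl = machine-≡ refl refl refl

  -- Head reduction on bare configurations, so that invariants of a run need not mention
  -- validity proofs.
  infix 4 _↝_
  data _↝_ : Config → Config → Set where
    load↝ : ∀ {i P} → (R , load i P , a ∷ S) ↝ (set R i a , P , S)
    app↝  : ∀ {i j l P} → get R i ≡ just a → get R j ≡ just b →
            (R , ap (app i j l P) , S) ↝ (set R l (a • b) , ap P , S)
    call↝ : ∀ {i} → get R i ≡ just a → (R , ap (cp (call i)) , S) ↝ config (#⁻¹ a ＠ S)

  →h⇒↝ : M →h N → config M ↝ config N
  →h⇒↝ (h-load refl refl refl refl refl)   = load↝
  →h⇒↝ (h-app refl gi gj refl refl refl)   = app↝ gi gj
  →h⇒↝ (h-call refl g)                     = call↝ g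

  ↝-deterministic : ∀ {c c₁ c₂} → c ↝ c₁ → c ↝ c₂ → c₁ ≡ c₂
  ↝-deterministic load↝ load↝ = refl
  ↝-deterministic (app↝ gi gj) (app↝ gi′ gj′) with trans (sym gi) gi′ | trans (sym gj) gj′
  ... | refl | refl = refl
  ↝-deterministic (call↝ g) (call↝ g′) with trans (sym g) g′
  ... | refl = refl

  →h-deterministic : M →h N → M →h X → N ≡ X
  →h-deterministic r r′ = config-injective (↝-deterministic (→h⇒↝ r) (→h⇒↝ r′))

  stuck-irreducible : Stuck M → ¬ (M →h N)
  stuck-irreducible (_ , _ , refl , refl) (h-load _ () _ _ _)
  stuck-irreducible (_ , _ , refl , refl) (h-app () _ _ _ _ _)
  stuck-irreducible (_ , _ , refl , refl) (h-call () _)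

  →h-＠ : ∀ S → M →h N → (M ＠ S) →h (N ＠ S)
  →h-＠ S (h-load refl refl refl refl refl) = h-load refl refl refl refl refl
  →h-＠ S (h-app refl gi gj refl refl refl) = h-app refl gi gj refl refl refl
  →h-＠ {M} S (h-call {a = a} refl g)       =
    subst ((M ＠ S) →h_) (sym (＠-++ (#⁻¹ a) (tape M) S)) (h-call refl g)

  ↠h-＠ : ∀ S → M ↠h N → (M ＠ S) ↠h (N ＠ S)
  ↠h-＠ S ε        = ε
  ↠h-＠ S (r ◅ rs) = →h-＠ S r ◅ ↠h-＠ S rs

  data StuckWithin : ℕ → Machine → Set where
    stuck : Stuck M → StuckWithin k M
    step  : M →h N → StuckWithin k N → StuckWithin (suc k) M

  GetsStuck : Machine → Set
  GetsStuck M = ∃ λ k → StuckWithin k M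

  stuckWithin-suc : StuckWithin k M → StuckWithin (suc k) M
  stuckWithin-suc (stuck s)  = stuck s
  stuckWithin-suc (step r h) = step r (stuckWithin-suc h)

  stuckWithin-→h : StuckWithin k M → M →h N → StuckWithin k N
  stuckWithin-→h (stuck s)  r′ = ⊥-elim (stuck-irreducible s r′)
  stuckWithin-→h (step r h) r′ = stuckWithin-suc (subst (StuckWithin _) (→h-deterministic r r′) h)

  stuckWithin-↠h : StuckWithin k M → M ↠h N → StuckWithin k N
  stuckWithin-↠h h ε        = h
  stuckWithin-↠h h (r ◅ rs) = stuckWithin-↠h (stuckWithin-→h h r) rs

  getsStuck-→h : M →h N → GetsStuck N → GetsStuck M
  getsStuck-→h r (k , h) = suc k , step r h

  getsStuck-↠h : M ↠h N → GetsStuck N → GetsStuck M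
  getsStuck-↠h ε        h = h
  getsStuck-↠h (r ◅ rs) h = getsStuck-→h r (getsStuck-↠h rs h)

  ↠stuck⇒getsStuck : ↠stuck M → GetsStuck M
  ↠stuck⇒getsStuck (N , red , s) = getsStuck-↠h red (0 , stuck s)

  module _ (Inv : Config → Set)
           (Inv-↝ : ∀ {c c′} → Inv c → c ↝ c′ → Inv c′)
           (Inv-unstuck : ∀ {R i P} → ¬ Inv (R , load i P , []))
           where

    invariant⇒¬stuckWithin : Inv (config M) → ¬ StuckWithin k M
    invariant⇒¬stuckWithin i (stuck (_ , _ , refl , refl)) = Inv-unstuck i
    invariant⇒¬stuckWithin i (step r h) = invariant⇒¬stuckWithin (Inv-↝ i (→h⇒↝ r)) h

    invariant⇒¬getsStuck : Inv (config M) → ¬ GetsStuck M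
    invariant⇒¬getsStuck i (k , h) = invariant⇒¬stuckWithin i h

  -- Indexing by k makes the definition well founded
  -- although these machines hold addresses in their registers and tapes again.
  mutual
    _≈[_]_ : A → ℕ → A → Set
    a ≈[ zero ]  b = ⊤
    a ≈[ suc k ] b =
      a ≈[ k ] b × StuckTransfers k (#⁻¹ a) (#⁻¹ b) × StuckTransfers k (#⁻¹ b) (#⁻¹ a)

    StuckTransfers : ℕ → Machine → Machine → Set
    StuckTransfers k M N = ∀ {S U} → LP.Pointwise _≈[ k ]_ S U →
                           StuckWithin k (M ＠ S) → GetsStuck (N ＠ U)

  Tape≈ : ℕ → List A → List A → Set
  Tape≈ k = LP.Pointwise _≈[ k ]_

  Regs≈ : ℕ → Regs → Regs → Set
  Regs≈ k = LP.Pointwise (MP.Pointwise _≈[ k ]_)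

  record Similar (k : ℕ) (X Y : Machine) : Set where
    constructor similar
    field
      regs≈ : Regs≈ k (regs X) (regs Y)
      prog≡ : prog X ≡ prog Y
      tape≈ : Tape≈ k (tape X) (tape Y)

  ≈-weaken : a ≈[ suc k ] b → a ≈[ k ] b
  ≈-weaken = proj₁

  Tape≈-weaken : Tape≈ (suc k) S U → Tape≈ k S U
  Tape≈-weaken = LP.map ≈-weaken

  Regs≈-weaken : ∀ {R R′} → Regs≈ (suc k) R R′ → Regs≈ k R R′
  Regs≈-weaken = LP.map λ { (MP.just a≈b) → MP.just (≈-weaken a≈b) ; MP.nothing → MP.nothing }

  ≈-sym : ∀ k → a ≈[ k ] b → b ≈[ k ] a
  ≈-sym zero    _             = tt
  ≈-sym (suc k) (a≈b , f , g) = ≈-sym k a≈b , g , f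

  similar-sym : Similar k X Y → Similar k Y X
  similar-sym {k} (similar R≈ refl S≈) =
    similar (LP.symmetric (MP.sym (≈-sym k)) R≈) refl (LP.symmetric (≈-sym k) S≈)

  transfers-• : StuckTransfers k (#⁻¹ a) (#⁻¹ b) → ∀ {c d} → c ≈[ k ] d →
                StuckTransfers k (#⁻¹ (a • c)) (#⁻¹ (b • d))
  transfers-• {k} {a} {b} f {c} {d} c≈d {S} {U} S≈ h =
    subst GetsStuck (sym (#⁻¹-• b d U))
      (f (c≈d ∷ S≈) (subst (StuckWithin k) (#⁻¹-• a c S) h))

  ≈-• : ∀ k {c d} → a ≈[ k ] b → c ≈[ k ] d → (a • c) ≈[ k ] (b • d)
  ≈-• zero    _             _   = tt
  ≈-• (suc k) (a≈b , f , g) c≈d =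
    ≈-• k a≈b (≈-weaken c≈d) ,
    transfers-• f (≈-weaken c≈d) ,
    transfers-• g (≈-sym k (≈-weaken c≈d))

  get-≈ : ∀ {R R′} i → Regs≈ k R R′ → get R i ≡ just a → ∃ λ b → get R′ i ≡ just b × a ≈[ k ] b
  get-≈ zero    (MP.just a≈b ∷ _) refl = _ , refl , a≈b
  get-≈ (suc i) (_ ∷ R≈)          g    = get-≈ i R≈ g

  set-≈ : ∀ {R R′} i → Regs≈ k R R′ → a ≈[ k ] b → Regs≈ k (set R i a) (set R′ i b)
  set-≈ i       []         a≈b = []
  set-≈ zero    (_ ∷ R≈)   a≈b = MP.just a≈b ∷ R≈
  set-≈ (suc i) (x≈y ∷ R≈) a≈b = x≈y ∷ set-≈ i R≈ a≈b

  occ-⊆ : ∀ {R R′} → Regs≈ k R R′ → occ R ⊆ occ R′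
  occ-⊆ (MP.just _ ∷ _)  zero    t = t
  occ-⊆ (_ ∷ R≈)         (suc i) t = occ-⊆ R≈ i t

  valid-≈ : ∀ {R R′} P → Regs≈ k R R′ →
            T (validP (length R) (occ R) P) → T (validP (length R′) (occ R′) P)
  valid-≈ P R≈ v =
    subst (λ r → T (validP r _ P)) (LP.Pointwise-length R≈) (monoP _ (occ-⊆ R≈) P v)

  similar-to : (X : Machine) → Regs≈ k (regs X) R → List A → Machine
  similar-to {R = R} X R≈ S = mach R (prog X) (valid-≈ (prog X) R≈ (valid X)) S

  similar-stuck : Stuck X → Similar k X Y → Stuck Y
  similar-stuck (i , P , refl , refl) (similar _ refl []) = i , P , refl , refl

  similar-getsStuck : StuckWithin k X → Similar k X Y → GetsStuck Y
  similar-getsStuck (stuck s) sim = 0 , stuck (similar-stuck s sim)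
  similar-getsStuck {k = suc k} {Y = Y} (step {N = X′} (h-load {i = i} refl refl refl refl refl) h)
                    (similar R≈ refl (_∷_ {y = b} a≈b S≈)) =
    getsStuck-→h (h-load {N = similar-to X′ R′≈ _} refl refl refl refl refl)
      (similar-getsStuck h (similar R′≈ refl (Tape≈-weaken S≈)))
    where
    R′≈ : Regs≈ k (regs X′) (set (regs Y) i b)
    R′≈ = set-≈ i (Regs≈-weaken R≈) (≈-weaken a≈b)
  similar-getsStuck {k = suc k} {Y = Y} (step {N = X′} (h-app {k = l} refl gi gj refl refl refl) h)
                    (similar R≈ refl S≈)
    with get-≈ _ R≈ gi | get-≈ _ R≈ gj
  ... | a′ , gi′ , a≈a′ | b′ , gj′ , b≈b′ =
    getsStuck-→h (h-app {N = similar-to X′ R′≈ _} refl gi′ gj′ refl refl refl)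
      (similar-getsStuck h (similar R′≈ refl (Tape≈-weaken S≈)))
    where
    R′≈ : Regs≈ k (regs X′) (set (regs Y) l (a′ • b′))
    R′≈ = set-≈ l (Regs≈-weaken R≈) (≈-• k (≈-weaken a≈a′) (≈-weaken b≈b′))
  similar-getsStuck (step (h-call refl g) h) (similar R≈ refl S≈) with get-≈ _ R≈ g
  ... | _ , g′ , (_ , transfers , _) = getsStuck-→h (h-call refl g′) (transfers (Tape≈-weaken S≈) h)

  similar⇒transfers : Similar k X Y → StuckTransfers k X Y
  similar⇒transfers (similar R≈ P≡ S≈) S≈′ h =
    similar-getsStuck h (similar R≈ P≡ (LP.++⁺ S≈ S≈′))

  mutual
    ≈-refl : ∀ k → a ≈[ k ] a
    ≈-refl zero    = tt
    ≈-refl (suc k) = ≈-refl k , transfers-refl k , transfers-refl k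

    transfers-refl : ∀ k → StuckTransfers k M M
    transfers-refl k =
      similar⇒transfers (similar (LP.refl (MP.refl (≈-refl k))) refl (LP.refl (≈-refl k)))

  transfers-trans : StuckTransfers k X Y → (∀ m → StuckTransfers m Y Z) → StuckTransfers k X Z
  transfers-trans f g S≈ h with f S≈ h
  ... | m , h′ = g m (LP.refl (≈-refl m)) h′

  transfers-↠h : X ↠h Y → StuckTransfers k Y Z → StuckTransfers k X Z
  transfers-↠h red f {S} S≈ h = f S≈ (stuckWithin-↠h h (↠h-＠ S red))

  transfers-↞h : X ↠h Y → StuckTransfers k Z Y → StuckTransfers k Z X
  transfers-↞h red f {U = U} S≈ h = getsStuck-↠h (↠h-＠ U red) (f S≈ h)

  -- Rule (2) of applicative equivalence: an empty tape is covered by the stuckness of Y,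
  -- a nonempty one by the hypothesis on the first argument.
  transfers-ext : ↠stuck Y → (∀ a m → StuckTransfers m (X ＠ (a ∷ [])) (Y ＠ (a ∷ []))) →
                  StuckTransfers k X Y
  transfers-ext {Y} Y-stuck f [] h = subst GetsStuck (sym (＠-[] Y)) (↠stuck⇒getsStuck Y-stuck)
  transfers-ext {Y} {X} {k} Y-stuck f (_∷_ {y = b} a≈b S≈) h
    with transfers-refl k (a≈b ∷ S≈) h
  ... | m , h′ =
    subst GetsStuck (＠-++ Y (b ∷ []) _)
      (f b m (LP.refl (≈-refl m)) (subst (StuckWithin m) (sym (＠-++ X (b ∷ []) _)) h′))

  mutual
    ≡ae⇒transfers : X ≡ae Y → ∀ k → StuckTransfers k X Y × StuckTransfers k Y X
    ≡ae⇒transfers ae-refl          k = transfers-refl k , transfers-refl k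
    ≡ae⇒transfers (ae-sym d)       k = swap (≡ae⇒transfers d k)
    ≡ae⇒transfers (ae-trans d₁ d₂) k =
      transfers-trans (proj₁ (≡ae⇒transfers d₁ k)) (proj₁ ∘ ≡ae⇒transfers d₂) ,
      transfers-trans (proj₂ (≡ae⇒transfers d₂ k)) (proj₂ ∘ ≡ae⇒transfers d₁)
    ≡ae⇒transfers (ae-red red Z=Y) k =
      transfers-↠h red (similar⇒transfers (=ae⇒similar Z=Y k)) ,
      transfers-↞h red (similar⇒transfers (similar-sym (=ae⇒similar Z=Y k)))
    ≡ae⇒transfers (ae-ext X-stuck Y-stuck f) k =
      transfers-ext Y-stuck (λ a m → proj₁ (≡ae⇒transfers (f a) m)) ,
      transfers-ext X-stuck (λ a m → proj₂ (≡ae⇒transfers (f a) m))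

    ≃ae⇒≈ : a ≃ae b → ∀ k → a ≈[ k ] b
    ≃ae⇒≈ d zero    = tt
    ≃ae⇒≈ d (suc k) = ≃ae⇒≈ d k , ≡ae⇒transfers d k

    =ae⇒similar : Induced._=R_ _≡ae_ #⁻¹ X Y → ∀ k → Similar k X Y
    =ae⇒similar (R≃ , P≡ , S≃) k = similar (≃ae⇒Regs≈ R≃ k) P≡ (≃ae⇒Tape≈ S≃ k)

    ≃ae⇒Tape≈ : LP.Pointwise _≃ae_ S U → ∀ k → Tape≈ k S U
    ≃ae⇒Tape≈ []        k = []
    ≃ae⇒Tape≈ (d ∷ S≃) k = ≃ae⇒≈ d k ∷ ≃ae⇒Tape≈ S≃ k

    ≃ae⇒Regs≈ : ∀ {R R′} → LP.Pointwise (MP.Pointwise _≃ae_) R R′ → ∀ k → Regs≈ k R R′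
    ≃ae⇒Regs≈ []                 k = []
    ≃ae⇒Regs≈ (MP.just d ∷ R≃)  k = MP.just (≃ae⇒≈ d k) ∷ ≃ae⇒Regs≈ R≃ k
    ≃ae⇒Regs≈ (MP.nothing ∷ R≃) k = MP.nothing ∷ ≃ae⇒Regs≈ R≃ k

  ≡ae-getsStuck : X ≡ae Y → GetsStuck X → GetsStuck Y
  ≡ae-getsStuck {X} {Y} d (k , h) =
    subst GetsStuck (＠-[] Y)
      (proj₁ (≡ae⇒transfers d k) [] (subst (StuckWithin k) (sym (＠-[] X)) h))

  ThS⇒getsStuck : ∀ {n} (M N : Λ n) → ThS M N → ∀ ρ →
                  GetsStuck (⟦ M ⟧ᵐ ＠ env ρ) → GetsStuck (⟦ N ⟧ᵐ ＠ env ρ)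
  ThS⇒getsStuck M N M=N ρ =
    subst GetsStuck (#⁻¹∘# (⟦ N ⟧ᵐ ＠ env ρ)) ∘ ≡ae-getsStuck (M=N ρ) ∘
    subst GetsStuck (sym (#⁻¹∘# (⟦ M ⟧ᵐ ＠ env ρ)))

  -- In normal form without being stuck.
  terminated : Machine
  terminated = mach [] (ap (cp ε)) tt []

  e : A
  e = # terminated

  data RunOfVarOnE : Config → Set where
    start    : RunOfVarOnE (nothing ∷ [] , load 0 (ap (cp (call 0))) , e ∷ [])
    loaded   : RunOfVarOnE (just e ∷ [] , ap (cp (call 0)) , [])
    finished : ∀ {R S} → RunOfVarOnE (R , ap (cp ε) , S)

  RunOfVarOnE-↝ : ∀ {c c′} → RunOfVarOnE c → c ↝ c′ → RunOfVarOnE c′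
  RunOfVarOnE-↝ start  load↝          = loaded
  RunOfVarOnE-↝ loaded (call↝ refl) rewrite #⁻¹∘# terminated = finished

  x₁ ηx₁ : Λ 1
  x₁  = var fzero
  ηx₁ = ƛ (var (fsuc fzero) · var fzero)

  ρe : Fin 1 → A
  ρe _ = e

  η-expansion-getsStuck : GetsStuck (⟦ ηx₁ ⟧ᵐ ＠ env ρe)
  η-expansion-getsStuck =
    1 , step {N = mach _ _ tt []} (h-load refl refl refl refl refl) (stuck (_ , _ , refl , refl))

  ¬ThS-η : ¬ ThS ηx₁ x₁
  ¬ThS-η η = invariant⇒¬getsStuck RunOfVarOnE RunOfVarOnE-↝ (λ ()) start
    (ThS⇒getsStuck ηx₁ x₁ η ρe η-expansion-getsStuck)

  V W : Machine
  V = ⟦ var {1} fzero ⟧ᵐ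
  W = ⟦ ω {0} ⟧ᵐ

  v w : A
  v = # V
  w = # W

  -- The arguments the machine of ω is applied to while Ω runs: w itself, wrapped in
  -- applications of the machine v of a variable.
  data ωArgument : A → Set where
    ω-self : ωArgument w
    v-wrap : ∀ {c} → ωArgument c → ωArgument (v • c)

  ωBody : AProg
  ωBody = app 1 0 1 (app 2 0 2 (app 1 2 3 (cp (call 3))))

  data RunOfΩ : Config → Set where
    Ω-app   : RunOfΩ (just w ∷ just w ∷ nothing ∷ [] , ap (app 0 1 2 (cp (call 2))) , [])
    Ω-call  : RunOfΩ (just w ∷ just w ∷ just (w • w) ∷ [] , ap (cp (call 2)) , [])
    ω-load  : ∀ {c S} → ωArgument c →
              RunOfΩ (nothing ∷ just v ∷ just v ∷ nothing ∷ [] , load 0 (ap ωBody) , c ∷ S)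
    ω-app₁  : ∀ {c S} → ωArgument c →
              RunOfΩ (just c ∷ just v ∷ just v ∷ nothing ∷ [] , ap ωBody , S)
    ω-app₂  : ∀ {c S} → ωArgument c →
              RunOfΩ (just c ∷ just (v • c) ∷ just v ∷ nothing ∷ [] ,
                      ap (app 2 0 2 (app 1 2 3 (cp (call 3)))) , S)
    ω-app₃  : ∀ {c S} → ωArgument c →
              RunOfΩ (just c ∷ just (v • c) ∷ just (v • c) ∷ nothing ∷ [] ,
                      ap (app 1 2 3 (cp (call 3))) , S)
    ω-call  : ∀ {c S} → ωArgument c →
              RunOfΩ (just c ∷ just (v • c) ∷ just (v • c) ∷ just ((v • c) • (v • c)) ∷ [] ,
                      ap (cp (call 3)) , S)
    v-load  : ∀ {c d S} → ωArgument c → ωArgument d →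
              RunOfΩ (nothing ∷ [] , load 0 (ap (cp (call 0))) , c ∷ d ∷ S)
    v-call  : ∀ {c d S} → ωArgument c → ωArgument d →
              RunOfΩ (just c ∷ [] , ap (cp (call 0)) , d ∷ S)

  RunOfΩ-≡ : X ≡ Y → RunOfΩ (config Y) → RunOfΩ (config X)
  RunOfΩ-≡ refl r = r

  RunOfΩ-↝ : ∀ {c c′} → RunOfΩ c → c ↝ c′ → RunOfΩ c′
  RunOfΩ-↝ Ω-app        (app↝ refl refl) = Ω-call
  RunOfΩ-↝ Ω-call       (call↝ refl)     = RunOfΩ-≡ (#-• W w []) (ω-load ω-self)
  RunOfΩ-↝ (ω-load c)   load↝            = ω-app₁ c
  RunOfΩ-↝ (ω-app₁ c)   (app↝ refl refl) = ω-app₂ c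
  RunOfΩ-↝ (ω-app₂ c)   (app↝ refl refl) = ω-app₃ c
  RunOfΩ-↝ (ω-app₃ c)   (app↝ refl refl) = ω-call c
  RunOfΩ-↝ (ω-call {c} c-arg) (call↝ refl) =
    RunOfΩ-≡ (trans (#⁻¹-• (v • c) (v • c) _) (#-• V c _)) (v-load c-arg (v-wrap c-arg))
  RunOfΩ-↝ (v-load c d) load↝            = v-call c d
  RunOfΩ-↝ (v-call ω-self d) (call↝ refl) = RunOfΩ-≡ (cong (_＠ _) (#⁻¹∘# W)) (ω-load d)
  RunOfΩ-↝ (v-call (v-wrap c) d) (call↝ refl) = RunOfΩ-≡ (#-• V _ _) (v-load c d)

  ρ₀ : Fin 0 → A
  ρ₀ ()

  ¬ThS-Ω-λΩ : ¬ ThS {0} Ω (ƛ Ω)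
  ¬ThS-Ω-λΩ Ω=λΩ = invariant⇒¬getsStuck RunOfΩ RunOfΩ-↝ (λ ()) Ω-app
    (ThS⇒getsStuck (ƛ Ω) Ω (ae-sym ∘ Ω=λΩ) ρ₀ (0 , stuck (_ , _ , refl , refl)))

proposition4p13 : (A : Set) → Countable A → (code : AM.Machine A ↔ A) →
    ¬ Extensional (AM.Coded.ThS A code) × ¬ Sensible (AM.Coded.ThS A code)
proposition4p13 A _ code =
  (λ extensional → ¬ThS-η (extensional x₁)) ,
  (λ sensible → ¬ThS-Ω-λΩ (proj₂ sensible Ω (ƛ Ω)
    (ΩHeaded⇒unsolvable {0} Ω-head) (ΩHeaded⇒unsolvable {0} (ƛ-head Ω-head))))
  where
  open Machines A code
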